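{- Let $(A_m,B_m,C_m)_{m\ge0}$ be defined by $A_0=B_0=C_0=0$, $A_1=1$, $B_1=2$, $C_1=3$ and for $m>1$: $A_m=\mathrm{mex}\{A_i,B_i,C_i:0\le i<m\}$, $B_m=A_m+1$, and $C_m=C_{m-1}+3$ if $A_m-A_{m-1}=2$, $C_m=C_{m-1}+5$ otherwise (the $\mathcal{P}$-positions of the Raleigh game are these triples and their permutations). A triple $(a,b,c)$ of positive integers with $a<b<c$ equals $(A_m,B_m,C_m)$ for some $m\ge1$ if and only if there is a word $w$ over $\{0,1\}$ such that, up to leading zeroes, $\mathrm{rep}_F(a-1)=w00$, $\mathrm{rep}_F(b-1)=w01$ and $\mathrm{rep}_F(c-1)=w010$.
   Context: $\mathrm{mex}(S)$ is the smallest non-negative integer not in $S$. Let $(F_i)_{i\ge0}$ be given by $F_0=1$, $F_1=2$, $F_{i+2}=F_{i+1}+F_i$. $\mathrm{rep}_F(m)$ is the greedy (Zeckendorf) expansion of $m$ in this system: the word $c_\ell\cdots c_0$ over $\{0,1\}$ with no factor $11$, $c_\ell=1$, and $m=\sum c_iF_i$; $\mathrm{rep}_F(0)$ is the empty word. "Up to leading zeroes" means the two words become equal after deleting initial zeroes. -}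

module Defs where

open import Data.Nat using (ℕ; zero; suc; _+_; _∸_; _≤ᵇ_; _≡ᵇ_)
open import Data.Bool using (Bool; true; false; if_then_else_; not)
open import Data.List using (List; []; _∷_; _++_; length; dropWhile; foldr)
open import Data.Product using (_×_; _,_)
open import Relation.Binary.PropositionalEquality using (_≡_)

elemᵇ : ℕ → List ℕ → Bool
elemᵇ n []       = false
elemᵇ n (x ∷ xs) = if n ≡ᵇ x then true else elemᵇ n xs

-- mex S : the smallest natural number not in the (finite) set S (given as a list).
-- mexFrom f k S searches k, k+1, ... with fuel f; fuel length S + 1 always suffices.
mexFrom : ℕ → ℕ → List ℕ → ℕ
mexFrom zero    k S = k
mexFrom (suc f) k S = if elemᵇ k S then mexFrom f (suc k) S else k

mex : List ℕ → ℕ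
mex S = mexFrom (suc (length S)) 0 S

-- state m = (list of all A_i, B_i, C_i for 0 ≤ i ≤ m , (A_m , B_m , C_m))
Triple : Set
Triple = ℕ × ℕ × ℕ

state : ℕ → List ℕ × Triple
state zero          = (0 ∷ 0 ∷ 0 ∷ [] , (0 , 0 , 0))
state (suc zero)    = (0 ∷ 0 ∷ 0 ∷ 1 ∷ 2 ∷ 3 ∷ [] , (1 , 2 , 3))
state (suc (suc k)) with state (suc k)
... | (vs , (a , b , c)) =
  let a' = mex vs
      c' = if (a' ∸ a) ≡ᵇ 2 then c + 3 else c + 5
  in (vs ++ (a' ∷ suc a' ∷ c' ∷ []) , (a' , suc a' , c'))

ABC : ℕ → Triple
ABC m with state m
... | (_ , t) = t

F : ℕ → ℕ
F zero          = 1
F (suc zero)    = 2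
F (suc (suc i)) = F (suc i) + F i

-- words over {0,1}: true = 1, false = 0, most significant digit first
Word : Set
Word = List Bool

-- greedy digits for positions i-1, ..., 0
greedy : ℕ → ℕ → Word
greedy zero    m = []
greedy (suc i) m = if F i ≤ᵇ m then true ∷ greedy i (m ∸ F i) else false ∷ greedy i m

stripZeros : Word → Word
stripZeros []          = []
stripZeros (false ∷ w) = stripZeros w
stripZeros (true ∷ w)  = true ∷ w

-- rep_F m : greedy (Zeckendorf) expansion; positions 0..m suffice since F_m > m.
-- Leading zeroes removed, so rep_F 0 = [].
repF : ℕ → Word
repF m = stripZeros (greedy (suc m) m)

_≈LZ_ : Word → Word → Set
u ≈LZ v = stripZeros u ≡ stripZeros v

-- Write s(n) for the value of rep_F(n) read one Fibonacci position higher. If the Zeckendorf word w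
-- has value n, then w00, w01 and w010 have values n + s(n), n + s(n) + 1 and n + 2 s(n) + 2, and the
-- claim is that (A_{n+1}, B_{n+1}, C_{n+1}) is these values plus one. By induction along the
-- recursion: s(n+1) - s(n) is 1 or 2 (incrementing a greedy word changes its shift by 1 or 2), which
-- is exactly the rule for C. For A, every Zeckendorf word ends in 00, 01 or 010, so every number
-- below the candidate already occurs in an earlier triple, while the candidate itself does not: it
-- is not an earlier A or B since the A's grow by at least 2, and not a C since the penultimate
-- digit of w00 is 0 but that of w010 is 1.

module Submission where

open import Defs
open import Data.Bool using (Bool; true; false; T; if_then_else_)
open import Data.Bool.Properties using (T-≡)
open import Data.Empty using (⊥; ⊥-elim)
open import Data.List using (List; []; _∷_; _++_; length)
open import Data.List.Membership.Propositional using (_∈_; _∉_)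
open import Data.List.Membership.Propositional.Properties using (∈-++⁺ˡ; ∈-++⁺ʳ; ∈-++⁻)
open import Data.List.Properties using (length-++; ++-assoc)
open import Data.List.Relation.Unary.Any using (here; there)
open import Data.Nat using (ℕ; zero; suc; _+_; _∸_; _<_; _≤_; _≤′_; _≤?_; _≤ᵇ_; _≡ᵇ_; z≤n; s≤s; ≤′-refl; ≤′-step)
open import Data.Nat.Properties
open import Data.Nat.Tactic.RingSolver using (solve-∀)
open import Data.Product using (_×_; _,_; ∃; ∃-syntax; Σ; proj₁; proj₂)
open import Data.Sum using (_⊎_; inj₁; inj₂)
open import Data.Unit using (⊤; tt)
open import Function.Bundles using (_⇔_; mk⇔; Equivalence)
open import Function.Properties.Equivalence using () renaming (trans to ⇔-trans)
open import Relation.Nullary using (yes; no)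
open import Algebra.Properties.CommutativeSemigroup +-commutativeSemigroup using (interchange)
open import Relation.Binary.Definitions using (tri<; tri≈; tri>)
open import Relation.Binary.PropositionalEquality
open ≡-Reasoning

elemᵇ⇒∈ : ∀ {y} xs → elemᵇ y xs ≡ true → y ∈ xs
elemᵇ⇒∈ {y} (x ∷ xs) p with y ≡ᵇ x in y≡ᵇx
... | true  = here (≡ᵇ⇒≡ y x (Equivalence.from T-≡ y≡ᵇx))
... | false = there (elemᵇ⇒∈ xs p)

∈⇒elemᵇ : ∀ {y xs} → y ∈ xs → elemᵇ y xs ≡ true
∈⇒elemᵇ {y} (here refl) rewrite Equivalence.to T-≡ (≡⇒≡ᵇ y y refl) = refl
∈⇒elemᵇ {y} {x ∷ _} (there p) with y ≡ᵇ x
... | true  = refl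
... | false = ∈⇒elemᵇ p

mexFrom-≡ : ∀ f k t S → k ≤ t → t < k + f → (∀ y → k ≤ y → y < t → y ∈ S) → t ∉ S →
            mexFrom f k S ≡ t
mexFrom-≡ zero k t S k≤t t<k+0 _ _ = ⊥-elim (<⇒≱ (subst (t <_) (+-identityʳ k) t<k+0) k≤t)
mexFrom-≡ (suc f) k t S k≤t t<k+f below t∉S with m≤n⇒m<n∨m≡n k≤t
... | inj₁ k<t rewrite ∈⇒elemᵇ (below k ≤-refl k<t) =
  mexFrom-≡ f (suc k) t S k<t (subst (t <_) (+-suc k f) t<k+f) (λ y k<y → below y (<⇒≤ k<y)) t∉S
... | inj₂ refl with elemᵇ k S in k∈ᵇS
...   | true  = ⊥-elim (t∉S (elemᵇ⇒∈ S k∈ᵇS))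
...   | false = refl

mex-≡ : ∀ t S → t ≤ length S → (∀ y → y < t → y ∈ S) → t ∉ S → mex S ≡ t
mex-≡ t S t≤∣S∣ below = mexFrom-≡ (suc (length S)) 0 t S z≤n (s≤s t≤∣S∣) (λ y _ → below y)

F-pos : ∀ i → 0 < F i
F-pos zero          = s≤s z≤n
F-pos (suc zero)    = s≤s z≤n
F-pos (suc (suc i)) = ≤-trans (F-pos (suc i)) (m≤m+n _ _)

F-≤-suc : ∀ i → F i ≤ F (suc i)
F-≤-suc zero    = s≤s z≤n
F-≤-suc (suc i) = m≤m+n _ _

F-mono′ : ∀ {i j} → i ≤′ j → F i ≤ F j
F-mono′ ≤′-refl                = ≤-refl
F-mono′ (≤′-step {n = j} i≤j) = ≤-trans (F-mono′ i≤j) (F-≤-suc j)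

F[1+i]≤F[i]+F[i] : ∀ i → F (suc i) ≤ F i + F i
F[1+i]≤F[i]+F[i] zero    = ≤-refl
F[1+i]≤F[i]+F[i] (suc i) = +-monoʳ-≤ (F (suc i)) (F-≤-suc i)

n<F[n] : ∀ n → n < F n
n<F[n] zero          = s≤s z≤n
n<F[n] (suc zero)    = s≤s (s≤s z≤n)
n<F[n] (suc (suc n)) = subst (_≤ F (suc n) + F n) (+-comm (suc (suc n)) 1) (+-mono-≤ (n<F[n] (suc n)) (F-pos n))

n<F[1+n] : ∀ n → n < F (suc n)
n<F[1+n] n = <-≤-trans (n<F[n] n) (F-≤-suc n)

F-pred : ∀ i → ∃[ p ] F i ≡ suc p
F-pred i with F i | F-pos i
... | suc p | _ = p , refl

-- `value k w` weighs the last digit of w by F k, so `value 0` is the numeration system of rep_F.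
value : ℕ → Word → ℕ
value k []          = 0
value k (true ∷ w)  = F (k + length w) + value k w
value k (false ∷ w) = value k w

Zeckendorf : Word → Set
Zeckendorf []                 = ⊤
Zeckendorf (false ∷ w)        = Zeckendorf w
Zeckendorf (true ∷ [])        = ⊤
Zeckendorf (true ∷ false ∷ w) = Zeckendorf w
Zeckendorf (true ∷ true ∷ w)  = ⊥

Zeckendorf-∷⁻ : ∀ d w → Zeckendorf (d ∷ w) → Zeckendorf w
Zeckendorf-∷⁻ false w           z = z
Zeckendorf-∷⁻ true  []          z = tt
Zeckendorf-∷⁻ true  (false ∷ w) z = z

Zeckendorf-++⁻ˡ : ∀ w v → Zeckendorf (w ++ v) → Zeckendorf w
Zeckendorf-++⁻ˡ []                 v _ = tt
Zeckendorf-++⁻ˡ (false ∷ w)        v z = Zeckendorf-++⁻ˡ w v z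
Zeckendorf-++⁻ˡ (true ∷ [])        v _ = tt
Zeckendorf-++⁻ˡ (true ∷ false ∷ w) v z = Zeckendorf-++⁻ˡ w v z

Zeckendorf-++⁻ʳ : ∀ w v → Zeckendorf (w ++ v) → Zeckendorf v
Zeckendorf-++⁻ʳ []      v z = z
Zeckendorf-++⁻ʳ (d ∷ w) v z = Zeckendorf-++⁻ʳ w v (Zeckendorf-∷⁻ d (w ++ v) z)

Zeckendorf-++0∷ : ∀ w v → Zeckendorf w → Zeckendorf v → Zeckendorf (w ++ false ∷ v)
Zeckendorf-++0∷ []                 v _  zv = zv
Zeckendorf-++0∷ (false ∷ w)        v zw zv = Zeckendorf-++0∷ w v zw zv
Zeckendorf-++0∷ (true ∷ [])        v _  zv = zv
Zeckendorf-++0∷ (true ∷ false ∷ w) v zw zv = Zeckendorf-++0∷ w v zw zv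

Zeckendorf-stripZeros : ∀ w → Zeckendorf w → Zeckendorf (stripZeros w)
Zeckendorf-stripZeros []          z = z
Zeckendorf-stripZeros (false ∷ w) z = Zeckendorf-stripZeros w z
Zeckendorf-stripZeros (true ∷ w)  z = z

Zeckendorf-stripZeros⁻ : ∀ w → Zeckendorf (stripZeros w) → Zeckendorf w
Zeckendorf-stripZeros⁻ []          z = z
Zeckendorf-stripZeros⁻ (false ∷ w) z = Zeckendorf-stripZeros⁻ w z
Zeckendorf-stripZeros⁻ (true ∷ w)  z = z

stripZeros-idem : ∀ w → stripZeros (stripZeros w) ≡ stripZeros w
stripZeros-idem []          = refl
stripZeros-idem (false ∷ w) = stripZeros-idem w
stripZeros-idem (true ∷ w)  = refl

value-stripZeros : ∀ k w → value k (stripZeros w) ≡ value k w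
value-stripZeros k []          = refl
value-stripZeros k (false ∷ w) = value-stripZeros k w
value-stripZeros k (true ∷ w)  = refl

value<F[length] : ∀ w → Zeckendorf w → value 0 w < F (length w)
value<F[length] []                 _ = s≤s z≤n
value<F[length] (false ∷ w)        z = <-≤-trans (value<F[length] w z) (F-≤-suc (length w))
value<F[length] (true ∷ [])        _ = s≤s (s≤s z≤n)
value<F[length] (true ∷ false ∷ w) z = +-monoʳ-< (F (suc (length w))) (value<F[length] w z)

leading-one-dominates : ∀ u v → Zeckendorf v → length u ≡ length v → F (length u) + value 0 u ≢ value 0 v
leading-one-dominates u v zv |u|≡|v| eq =
  <⇒≱ (value<F[length] v zv) (subst (_≤ value 0 v) (cong F |u|≡|v|) (subst (F (length u) ≤_) eq (m≤m+n _ _)))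

Zeckendorf-unique : ∀ u v → Zeckendorf u → Zeckendorf v → length u ≡ length v → value 0 u ≡ value 0 v → u ≡ v
Zeckendorf-unique [] [] _ _ _ _ = refl
Zeckendorf-unique (false ∷ u) (false ∷ v) zu zv |u|≡|v| eq =
  cong (false ∷_) (Zeckendorf-unique u v zu zv (suc-injective |u|≡|v|) eq)
Zeckendorf-unique (true ∷ u) (true ∷ v) zu zv |u|≡|v| eq =
  cong (true ∷_) (Zeckendorf-unique u v (Zeckendorf-∷⁻ true u zu) (Zeckendorf-∷⁻ true v zv) |u|≡|v|′
    (+-cancelˡ-≡ (F (length u)) _ _ (trans eq (cong (λ l → F l + value 0 v) (sym |u|≡|v|′)))))
  where
  |u|≡|v|′ : length u ≡ length v
  |u|≡|v|′ = suc-injective |u|≡|v|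
Zeckendorf-unique (true ∷ u) (false ∷ v) _ zv |u|≡|v| eq =
  ⊥-elim (leading-one-dominates u v zv (suc-injective |u|≡|v|) eq)
Zeckendorf-unique (false ∷ u) (true ∷ v) zu _ |u|≡|v| eq =
  ⊥-elim (leading-one-dominates v u zu (suc-injective (sym |u|≡|v|)) (sym eq))

greedy-1 : ∀ i {m} → F i ≤ m → greedy (suc i) m ≡ true ∷ greedy i (m ∸ F i)
greedy-1 i {m} F≤m with F i ≤ᵇ m in F≤ᵇm
... | true  = refl
... | false = ⊥-elim (subst T F≤ᵇm (≤⇒≤ᵇ F≤m))

greedy-0 : ∀ i {m} → m < F i → greedy (suc i) m ≡ false ∷ greedy i m
greedy-0 i {m} m<F with F i ≤ᵇ m in F≤ᵇm
... | true  = ⊥-elim (<⇒≱ m<F (≤ᵇ⇒≤ (F i) m (Equivalence.from T-≡ F≤ᵇm)))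
... | false = refl

length-greedy : ∀ i m → length (greedy i m) ≡ i
length-greedy zero    m = refl
length-greedy (suc i) m with F i ≤ᵇ m
... | true  = cong suc (length-greedy i (m ∸ F i))
... | false = cong suc (length-greedy i m)

value-greedy-1 : ∀ k i {m} → F i ≤ m → value k (greedy (suc i) m) ≡ F (k + i) + value k (greedy i (m ∸ F i))
value-greedy-1 k i {m} F≤m rewrite greedy-1 i F≤m | length-greedy i (m ∸ F i) = refl

value-greedy-0 : ∀ k i {m} → m < F i → value k (greedy (suc i) m) ≡ value k (greedy i m)
value-greedy-0 k i m<F rewrite greedy-0 i m<F = refl

value-greedy-zero : ∀ k i → value k (greedy i 0) ≡ 0
value-greedy-zero k zero    = refl
value-greedy-zero k (suc i) = trans (value-greedy-0 k i (F-pos i)) (value-greedy-zero k i)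

∸F-< : ∀ {i m} → F i ≤ m → m < F (suc i) → m ∸ F i < F i
∸F-< {i} {m} F≤m m<F = +-cancelˡ-< (F i) (m ∸ F i) (F i)
  (subst (_< F i + F i) (sym (m+[n∸m]≡n F≤m)) (<-≤-trans m<F (F[1+i]≤F[i]+F[i] i)))

value-greedy : ∀ i m → m < F i → value 0 (greedy i m) ≡ m
value-greedy zero    zero    _         = refl
value-greedy zero    (suc m) (s≤s ())
value-greedy (suc i) m m<F with F i ≤? m
... | yes F≤m = begin
  value 0 (greedy (suc i) m)          ≡⟨ value-greedy-1 0 i F≤m ⟩
  F i + value 0 (greedy i (m ∸ F i)) ≡⟨ cong (F i +_) (value-greedy i (m ∸ F i) (∸F-< {i} F≤m m<F)) ⟩
  F i + (m ∸ F i)                    ≡⟨ m+[n∸m]≡n F≤m ⟩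
  m                                  ∎
... | no F≰m = trans (value-greedy-0 0 i (≰⇒> F≰m)) (value-greedy i m (≰⇒> F≰m))

∸F-<F[pred] : ∀ {j m} → F (suc j) ≤ m → m < F (suc (suc j)) → m ∸ F (suc j) < F j
∸F-<F[pred] {j} {m} F≤m m<F =
  +-cancelˡ-< (F (suc j)) (m ∸ F (suc j)) (F j) (subst (_< F (suc j) + F j) (sym (m+[n∸m]≡n F≤m)) m<F)

-- After a greedy digit 1 the remainder is below F (i - 1), which forces the next digit to be 0.
greedy-Zeckendorf : ∀ i m → m < F i → Zeckendorf (greedy i m)
greedy-Zeckendorf zero m _ = tt
greedy-Zeckendorf (suc i) m m<F with F i ≤? m
... | no F≰m rewrite greedy-0 i (≰⇒> F≰m) = greedy-Zeckendorf i m (≰⇒> F≰m)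
greedy-Zeckendorf (suc zero) m _ | yes F≤m rewrite greedy-1 zero F≤m = tt
greedy-Zeckendorf (suc (suc j)) m m<F | yes F≤m
  rewrite greedy-1 (suc j) F≤m | greedy-0 j (∸F-<F[pred] {j} F≤m m<F)
  = greedy-Zeckendorf j _ (∸F-<F[pred] {j} F≤m m<F)

stripZeros-greedy-≤′ : ∀ {i j m} → i ≤′ j → m < F i → stripZeros (greedy j m) ≡ stripZeros (greedy i m)
stripZeros-greedy-≤′ ≤′-refl _ = refl
stripZeros-greedy-≤′ (≤′-step {n = j} i≤j) m<F rewrite greedy-0 j (<-≤-trans m<F (F-mono′ i≤j)) =
  stripZeros-greedy-≤′ i≤j m<F

repF-greedy : ∀ i {m} → m < F i → repF m ≡ stripZeros (greedy i m)
repF-greedy i {m} m<F with ≤-total i (suc m)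
... | inj₁ i≤1+m = stripZeros-greedy-≤′ (≤⇒≤′ i≤1+m) m<F
... | inj₂ 1+m≤i = sym (stripZeros-greedy-≤′ (≤⇒≤′ 1+m≤i) (n<F[1+n] m))

value-greedy-repF : ∀ k i {m} → m < F i → value k (greedy i m) ≡ value k (repF m)
value-greedy-repF k i {m} m<F = sym (trans (cong (value k) (repF-greedy i m<F)) (value-stripZeros k (greedy i m)))

repF-Zeckendorf : ∀ n → Zeckendorf (repF n)
repF-Zeckendorf n = Zeckendorf-stripZeros (greedy (suc n) n) (greedy-Zeckendorf (suc n) n (n<F[1+n] n))

value-repF : ∀ n → value 0 (repF n) ≡ n
value-repF n = trans (value-stripZeros 0 (greedy (suc n) n)) (value-greedy (suc n) n (n<F[1+n] n))

repF-value : ∀ u → Zeckendorf u → repF (value 0 u) ≡ stripZeros u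
repF-value u zu = trans (repF-greedy (length u) u<F) (cong stripZeros
  (Zeckendorf-unique (greedy (length u) N) u (greedy-Zeckendorf (length u) N u<F) zu
    (length-greedy (length u) N) (value-greedy (length u) N u<F)))
  where
  N : ℕ
  N = value 0 u
  u<F : N < F (length u)
  u<F = value<F[length] u zu

repF-≈LZ : ∀ x u → repF x ≈LZ u ⇔ (Zeckendorf u × value 0 u ≡ x)
repF-≈LZ x u = mk⇔ to from
  where
  repF≡ : repF x ≈LZ u → repF x ≡ stripZeros u
  repF≡ x≈u = trans (sym (stripZeros-idem (greedy (suc x) x))) x≈u
  to : repF x ≈LZ u → Zeckendorf u × value 0 u ≡ x
  to x≈u = Zeckendorf-stripZeros⁻ u (subst Zeckendorf (repF≡ x≈u) (repF-Zeckendorf x))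
         , (begin
             value 0 u              ≡⟨ sym (value-stripZeros 0 u) ⟩
             value 0 (stripZeros u) ≡⟨ cong (value 0) (sym (repF≡ x≈u)) ⟩
             value 0 (repF x)       ≡⟨ value-repF x ⟩
             x                      ∎)
  from : Zeckendorf u × value 0 u ≡ x → repF x ≈LZ u
  from (zu , refl) = trans (cong stripZeros (repF-value u zu)) (stripZeros-idem u)

shift : ℕ → ℕ
shift n = value 1 (repF n)

value₁≡shift : ∀ w → Zeckendorf w → value 1 w ≡ shift (value 0 w)
value₁≡shift w zw = sym (trans (cong (value 1) (repF-value w zw)) (value-stripZeros 1 w))

OneOrTwoMore : ℕ → ℕ → Set
OneOrTwoMore x y = y ≡ suc x ⊎ y ≡ suc (suc x)

+-OneOrTwoMore : ∀ c {x y} → OneOrTwoMore x y → OneOrTwoMore (c + x) (c + y)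
+-OneOrTwoMore c {x} (inj₁ refl) = inj₁ (+-suc c x)
+-OneOrTwoMore c {x} (inj₂ refl) = inj₂ (trans (+-suc c (suc x)) (cong suc (+-suc c x)))

-- The greedy word of F i - 1 is 1010…, so its shift is F (i + 1) - 1 or F (i + 1) - 2 according to the parity of i.
value₁-greedy-pred : ∀ i m → suc m ≡ F i → OneOrTwoMore (value 1 (greedy i m)) (F (suc i))
value₁-greedy-pred zero          zero       refl  = inj₂ refl
value₁-greedy-pred (suc zero)    (suc zero) refl  = inj₁ refl
value₁-greedy-pred (suc (suc j)) m          1+m≡F with F-pred j
... | p , F≡1+p
  rewrite suc-injective (trans 1+m≡F (trans (cong (F (suc j) +_) F≡1+p) (+-suc (F (suc j)) p)))
        | value-greedy-1 1 (suc j) (m≤m+n (F (suc j)) p)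
        | m+n∸m≡n (F (suc j)) p
        | value-greedy-0 1 j (subst (p <_) (sym F≡1+p) ≤-refl)
  = +-OneOrTwoMore (F (suc (suc j))) (value₁-greedy-pred j p (sym F≡1+p))

-- Only at a carry, m + 1 = F i, does the leading digit change; that case is value₁-greedy-pred.
value₁-greedy-suc : ∀ i m → suc m < F i → OneOrTwoMore (value 1 (greedy i m)) (value 1 (greedy i (suc m)))
value₁-greedy-suc zero    m (s≤s ())
value₁-greedy-suc (suc i) m 2+m≤F with F i ≤? m | F i ≤? suc m
... | yes F≤m | yes F≤1+m
  rewrite value-greedy-1 1 i F≤m | value-greedy-1 1 i F≤1+m | +-∸-assoc 1 F≤m
  = +-OneOrTwoMore (F (suc i))
      (value₁-greedy-suc i (m ∸ F i) (subst (_< F i) (+-∸-assoc 1 F≤m) (∸F-< {i} F≤1+m 2+m≤F)))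
... | yes F≤m | no F≰1+m = ⊥-elim (F≰1+m (≤-trans F≤m (n≤1+n m)))
... | no F≰m  | no F≰1+m
  rewrite value-greedy-0 1 i (≰⇒> F≰m) | value-greedy-0 1 i (≰⇒> F≰1+m)
  = value₁-greedy-suc i m (≰⇒> F≰1+m)
... | no F≰m  | yes F≤1+m
  rewrite value-greedy-0 1 i (≰⇒> F≰m) | value-greedy-1 1 i F≤1+m
        | m≤n⇒m∸n≡0 (≰⇒> F≰m) | value-greedy-zero 1 i | +-identityʳ (F (suc i))
  = value₁-greedy-pred i m (≤-antisym (≰⇒> F≰m) F≤1+m)

shift-step : ∀ n → OneOrTwoMore (shift n) (shift (suc n))
shift-step n = subst₂ OneOrTwoMore
  (value-greedy-repF 1 (suc (suc n)) (<-≤-trans (n<F[1+n] n) (F-≤-suc (suc n))))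
  (value-greedy-repF 1 (suc (suc n)) (n<F[1+n] (suc n)))
  (value₁-greedy-suc (suc (suc n)) n (n<F[1+n] (suc n)))

value-++ : ∀ k w v → value k (w ++ v) ≡ value (k + length v) w + value k v
value-++ k []          v = refl
value-++ k (false ∷ w) v = value-++ k w v
value-++ k (true ∷ w)  v = begin
  F (k + length (w ++ v)) + value k (w ++ v)
    ≡⟨ cong₂ _+_ (cong F k+∣w++v∣) (value-++ k w v) ⟩
  F (k + length v + length w) + (value (k + length v) w + value k v)
    ≡⟨ sym (+-assoc (F (k + length v + length w)) _ _) ⟩
  F (k + length v + length w) + value (k + length v) w + value k v
    ∎
  where
  k+∣w++v∣ : k + length (w ++ v) ≡ k + length v + length w
  k+∣w++v∣ = trans (cong (k +_) (trans (length-++ w) (+-comm (length w) (length v)))) (sym (+-assoc k _ _))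

value-2+ : ∀ k w → value (suc (suc k)) w ≡ value (suc k) w + value k w
value-2+ k []          = refl
value-2+ k (false ∷ w) = value-2+ k w
value-2+ k (true ∷ w)  rewrite value-2+ k w =
  interchange (F (suc (k + length w))) (F (k + length w)) (value (suc k) w) (value k w)

-- For a Zeckendorf word w of value n, these are the values of w00, w01 and w010.
val00 val01 val010 : ℕ → ℕ
val00 n  = n + shift n
val01 n  = suc (val00 n)
val010 n = val00 n + shift n + 2

value₂≡val00 : ∀ w → Zeckendorf w → value 2 w ≡ val00 (value 0 w)
value₂≡val00 w zw = begin
  value 2 w                     ≡⟨ value-2+ 0 w ⟩
  value 1 w + value 0 w         ≡⟨ cong (_+ value 0 w) (value₁≡shift w zw) ⟩
  shift (value 0 w) + value 0 w ≡⟨ +-comm (shift (value 0 w)) (value 0 w) ⟩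
  val00 (value 0 w)             ∎

value-++00 : ∀ w → Zeckendorf w → value 0 (w ++ false ∷ false ∷ []) ≡ val00 (value 0 w)
value-++00 w zw = trans (value-++ 0 w _) (trans (+-identityʳ (value 2 w)) (value₂≡val00 w zw))

value-++01 : ∀ w → Zeckendorf w → value 0 (w ++ false ∷ true ∷ []) ≡ val01 (value 0 w)
value-++01 w zw = trans (value-++ 0 w _) (trans (cong (_+ 1) (value₂≡val00 w zw)) (+-comm _ 1))

value-++010 : ∀ w → Zeckendorf w → value 0 (w ++ false ∷ true ∷ false ∷ []) ≡ val010 (value 0 w)
value-++010 w zw = begin
  value 0 (w ++ false ∷ true ∷ false ∷ []) ≡⟨ value-++ 0 w _ ⟩
  value 3 w + 2                             ≡⟨ cong (_+ 2) (value-2+ 1 w) ⟩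
  value 2 w + value 1 w + 2                 ≡⟨ cong₂ (λ a b → a + b + 2) (value₂≡val00 w zw) (value₁≡shift w zw) ⟩
  val010 (value 0 w)                        ∎

repF-val00 : ∀ n → repF (val00 n) ≈LZ (repF n ++ false ∷ false ∷ [])
repF-val00 n = Equivalence.from (repF-≈LZ (val00 n) (repF n ++ false ∷ false ∷ []))
  (Zeckendorf-++0∷ (repF n) (false ∷ []) (repF-Zeckendorf n) tt , trans (value-++00 (repF n) (repF-Zeckendorf n)) (cong val00 (value-repF n)))

repF-val01 : ∀ n → repF (val01 n) ≈LZ (repF n ++ false ∷ true ∷ [])
repF-val01 n = Equivalence.from (repF-≈LZ (val01 n) (repF n ++ false ∷ true ∷ []))
  (Zeckendorf-++0∷ (repF n) (true ∷ []) (repF-Zeckendorf n) tt , trans (value-++01 (repF n) (repF-Zeckendorf n)) (cong val01 (value-repF n)))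

repF-val010 : ∀ n → repF (val010 n) ≈LZ (repF n ++ false ∷ true ∷ false ∷ [])
repF-val010 n = Equivalence.from (repF-≈LZ (val010 n) (repF n ++ false ∷ true ∷ false ∷ []))
  (Zeckendorf-++0∷ (repF n) (true ∷ false ∷ []) (repF-Zeckendorf n) tt , trans (value-++010 (repF n) (repF-Zeckendorf n)) (cong val010 (value-repF n)))

-- Words are read with implicit leading zeros, so a word of length below 2 has penultimate digit 0.
penultimate : Word → Bool
penultimate []              = false
penultimate (_ ∷ [])        = false
penultimate (d ∷ _ ∷ [])    = d
penultimate (_ ∷ d ∷ e ∷ w) = penultimate (d ∷ e ∷ w)

penultimate-stripZeros : ∀ w → penultimate (stripZeros w) ≡ penultimate w
penultimate-stripZeros []                  = refl
penultimate-stripZeros (true ∷ w)          = refl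
penultimate-stripZeros (false ∷ [])        = refl
penultimate-stripZeros (false ∷ d ∷ [])    = penultimate-stripZeros (d ∷ [])
penultimate-stripZeros (false ∷ d ∷ e ∷ w) = penultimate-stripZeros (d ∷ e ∷ w)

penultimate-++ : ∀ w a b → penultimate (w ++ a ∷ b ∷ []) ≡ a
penultimate-++ []              a b = refl
penultimate-++ (_ ∷ [])        a b = refl
penultimate-++ (_ ∷ _ ∷ [])    a b = refl
penultimate-++ (_ ∷ d ∷ e ∷ w) a b = penultimate-++ (d ∷ e ∷ w) a b

val00≢val010 : ∀ n k → val00 n ≢ val010 k
val00≢val010 n k e with (begin
  false                                                 ≡⟨ sym (penultimate-++ (repF n) false false) ⟩
  penultimate (repF n ++ false ∷ false ∷ [])            ≡⟨ sym (penultimate-stripZeros (repF n ++ false ∷ false ∷ [])) ⟩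
  penultimate (stripZeros (repF n ++ false ∷ false ∷ [])) ≡⟨ cong penultimate (sym (repF-val00 n)) ⟩
  penultimate (stripZeros (repF (val00 n)))             ≡⟨ cong (λ x → penultimate (stripZeros (repF x))) e ⟩
  penultimate (stripZeros (repF (val010 k)))            ≡⟨ cong penultimate (repF-val010 k) ⟩
  penultimate (stripZeros (repF k ++ false ∷ true ∷ false ∷ [])) ≡⟨ penultimate-stripZeros (repF k ++ false ∷ true ∷ false ∷ []) ⟩
  penultimate (repF k ++ false ∷ true ∷ false ∷ [])     ≡⟨ cong penultimate (sym (++-assoc (repF k) (false ∷ []) (true ∷ false ∷ []))) ⟩
  penultimate ((repF k ++ false ∷ []) ++ true ∷ false ∷ []) ≡⟨ penultimate-++ (repF k ++ false ∷ []) true false ⟩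
  true                                                  ∎)
... | ()

Entry : ℕ → ℕ → Set
Entry k y = y ≡ val00 k ⊎ y ≡ val01 k ⊎ y ≡ val010 k

split-last-three : ∀ x y z u → Σ Word λ w → Σ Bool λ d₂ → Σ Bool λ d₁ → Σ Bool λ d₀ →
                   x ∷ y ∷ z ∷ u ≡ w ++ d₂ ∷ d₁ ∷ d₀ ∷ []
split-last-three x y z []      = [] , x , y , z , refl
split-last-three x y z (v ∷ u) with split-last-three y z v u
... | w , d₂ , d₁ , d₀ , eq = x ∷ w , d₂ , d₁ , d₀ , cong (x ∷_) eq

entry-of-word : ∀ w d₂ d₁ d₀ → Zeckendorf (w ++ d₂ ∷ d₁ ∷ d₀ ∷ []) →
                ∃ λ k → Entry k (value 0 (w ++ d₂ ∷ d₁ ∷ d₀ ∷ []))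
entry-of-word w d₂ false false z = value 0 w′ , inj₁ (trans (cong (value 0) (sym assoc))
  (value-++00 w′ (Zeckendorf-++⁻ˡ w′ (false ∷ false ∷ []) (subst Zeckendorf (sym assoc) z))))
  where
  w′ : Word
  w′ = w ++ d₂ ∷ []
  assoc : w′ ++ false ∷ false ∷ [] ≡ w ++ d₂ ∷ false ∷ false ∷ []
  assoc = ++-assoc w (d₂ ∷ []) (false ∷ false ∷ [])
entry-of-word w d₂ false true z = value 0 w′ , inj₂ (inj₁ (trans (cong (value 0) (sym assoc))
  (value-++01 w′ (Zeckendorf-++⁻ˡ w′ (false ∷ true ∷ []) (subst Zeckendorf (sym assoc) z)))))
  where
  w′ : Word
  w′ = w ++ d₂ ∷ []
  assoc : w′ ++ false ∷ true ∷ [] ≡ w ++ d₂ ∷ false ∷ true ∷ []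
  assoc = ++-assoc w (d₂ ∷ []) (false ∷ true ∷ [])
entry-of-word w false true false z =
  value 0 w , inj₂ (inj₂ (value-++010 w (Zeckendorf-++⁻ˡ w (false ∷ true ∷ false ∷ []) z)))
entry-of-word w true true false z = ⊥-elim (Zeckendorf-++⁻ʳ w (true ∷ true ∷ false ∷ []) z)
entry-of-word w d₂ true true z =
  ⊥-elim (Zeckendorf-∷⁻ d₂ (true ∷ true ∷ []) (Zeckendorf-++⁻ʳ w (d₂ ∷ true ∷ true ∷ []) z))

cover : ∀ y → ∃ λ k → Entry k y
cover y with split-last-three false false false (repF y)
... | w , d₂ , d₁ , d₀ , eq =
  subst (λ x → ∃ λ k → Entry k x) (trans (cong (value 0) (sym eq)) (value-repF y))
    (entry-of-word w d₂ d₁ d₀ (subst Zeckendorf eq (repF-Zeckendorf y)))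

val-suc : ∀ n d → shift (suc n) ≡ d + shift n →
          val00 (suc n) ≡ suc d + val00 n × val010 (suc n) ≡ suc (d + d) + val010 n
val-suc n d e rewrite e = arith₀₀ n d (shift n) , arith₀₁₀ n d (shift n)
  where
  arith₀₀ : ∀ n d s → suc n + (d + s) ≡ suc d + (n + s)
  arith₀₀ = solve-∀
  arith₀₁₀ : ∀ n d s → suc n + (d + s) + (d + s) + 2 ≡ suc (d + d) + (n + s + s + 2)
  arith₀₁₀ = solve-∀

val-step : ∀ n → (val00 (suc n) ≡ 2 + val00 n × val010 (suc n) ≡ 3 + val010 n)
               ⊎ (val00 (suc n) ≡ 3 + val00 n × val010 (suc n) ≡ 5 + val010 n)
val-step n with shift-step n
... | inj₁ e = inj₁ (val-suc n 1 e)
... | inj₂ e = inj₂ (val-suc n 2 e)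

val00-suc-bounds : ∀ n → 2 + val00 n ≤ val00 (suc n) × val00 (suc n) ≤ 3 + val00 n
val00-suc-bounds n with val-step n
... | inj₁ (e , _) = ≤-reflexive (sym e) , ≤-trans (≤-reflexive e) (n≤1+n _)
... | inj₂ (e , _) = ≤-trans (n≤1+n _) (≤-reflexive (sym e)) , ≤-reflexive e

val00-gap′ : ∀ {j k} → suc j ≤′ k → 2 + val00 j ≤ val00 k
val00-gap′ {j} ≤′-refl = proj₁ (val00-suc-bounds j)
val00-gap′ (≤′-step {n = k} j<k) =
  ≤-trans (val00-gap′ j<k) (≤-trans (m≤n+m (val00 k) 2) (proj₁ (val00-suc-bounds k)))

val00-gap : ∀ {j k} → j < k → 2 + val00 j ≤ val00 k
val00-gap j<k = val00-gap′ (≤⇒≤′ j<k)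

val00-cancel-< : ∀ {j k} → val00 j < val00 k → j < k
val00-cancel-< {j} {k} v< with <-cmp j k
... | tri< j<k _ _ = j<k
... | tri≈ _ refl _ = ⊥-elim (<-irrefl refl v<)
... | tri> _ _ k<j = ⊥-elim (<-asym v< (≤-trans (n≤1+n _) (val00-gap k<j)))

val00≤entry : ∀ k {y} → Entry k y → val00 k ≤ y
val00≤entry k (inj₁ refl)        = ≤-refl
val00≤entry k (inj₂ (inj₁ refl)) = n≤1+n (val00 k)
val00≤entry k (inj₂ (inj₂ refl)) = ≤-trans (m≤m+n (val00 k) (shift k)) (m≤m+n _ 2)

-- Membership in the list of `state (suc n)`: 0 and A_i, B_i, C_i (each 1 + an entry of i - 1) for 1 ≤ i ≤ n + 1.
Listed : ℕ → ℕ → Set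
Listed n zero    = ⊤
Listed n (suc y) = ∃ λ k → k ≤ n × Entry k y

Listed-mono : ∀ {m n} y → m ≤ n → Listed m y → Listed n y
Listed-mono zero    _   _               = tt
Listed-mono (suc y) m≤n (k , k≤m , e) = k , ≤-trans k≤m m≤n , e

tripleFrom : ℕ → Triple
tripleFrom n = suc (val00 n) , suc (val01 n) , suc (val010 n)

record StateInvariant (n : ℕ) : Set where
  field
    values   : List ℕ
    state≡   : state (suc n) ≡ (values , tripleFrom n)
    sound    : ∀ {y} → y ∈ values → Listed n y
    complete : ∀ {y} → Listed n y → y ∈ values
    long     : 4 + val00 n ≤ length values

initial : StateInvariant 0
initial = record
  { values = 0 ∷ 0 ∷ 0 ∷ 1 ∷ 2 ∷ 3 ∷ [] ; state≡ = refl ; sound = sound ; complete = complete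
  ; long = s≤s (s≤s (s≤s (s≤s z≤n))) }
  where
  sound : ∀ {y} → y ∈ 0 ∷ 0 ∷ 0 ∷ 1 ∷ 2 ∷ 3 ∷ [] → Listed 0 y
  sound (here refl)                                     = tt
  sound (there (here refl))                             = tt
  sound (there (there (here refl)))                     = tt
  sound (there (there (there (here refl))))             = 0 , z≤n , inj₁ refl
  sound (there (there (there (there (here refl)))))     = 0 , z≤n , inj₂ (inj₁ refl)
  sound (there (there (there (there (there (here refl)))))) = 0 , z≤n , inj₂ (inj₂ refl)
  complete : ∀ {y} → Listed 0 y → y ∈ 0 ∷ 0 ∷ 0 ∷ 1 ∷ 2 ∷ 3 ∷ []
  complete {zero} _                             = here refl
  complete {suc y} (0 , z≤n , inj₁ refl)        = there (there (there (here refl)))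
  complete {suc y} (0 , z≤n , inj₂ (inj₁ refl)) = there (there (there (there (here refl))))
  complete {suc y} (0 , z≤n , inj₂ (inj₂ refl)) = there (there (there (there (there (here refl)))))

next : ∀ {n} → StateInvariant n → StateInvariant (suc n)
next {n} I = record
  { values = values′ ; state≡ = state≡′ ; sound = sound′ ; complete = complete′ ; long = long′ }
  where
  open StateInvariant I
  a′ : ℕ
  a′ = suc (val00 (suc n))
  values′ : List ℕ
  values′ = values ++ a′ ∷ suc a′ ∷ suc (val010 (suc n)) ∷ []

  below-a′ : ∀ y → y < a′ → y ∈ values
  below-a′ zero    _       = complete tt
  below-a′ (suc y) (s≤s y<) with cover y
  ... | k , e = complete (k , ≤-pred (val00-cancel-< (≤-<-trans (val00≤entry k e) y<)) , e)

  a′∉ : a′ ∉ values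
  a′∉ p with sound p
  ... | k , k≤n , inj₁ e        = <-irrefl (sym e) (≤-trans (n≤1+n _) (val00-gap (s≤s k≤n)))
  ... | k , k≤n , inj₂ (inj₁ e) = <-irrefl (sym e) (val00-gap (s≤s k≤n))
  ... | k , k≤n , inj₂ (inj₂ e) = val00≢val010 (suc n) k e

  mex≡a′ : mex values ≡ a′
  mex≡a′ = mex-≡ a′ values (≤-trans (s≤s (proj₂ (val00-suc-bounds n))) long) below-a′ a′∉

  c′≡ : (if (a′ ∸ suc (val00 n)) ≡ᵇ 2 then suc (val010 n) + 3 else suc (val010 n) + 5) ≡ suc (val010 (suc n))
  c′≡ with val-step n
  ... | inj₁ (ea , ec) rewrite ea | ec | m+n∸n≡m 2 (val00 n) = cong suc (+-comm (val010 n) 3)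
  ... | inj₂ (ea , ec) rewrite ea | ec | m+n∸n≡m 3 (val00 n) = cong suc (+-comm (val010 n) 5)

  state≡′ : state (suc (suc n)) ≡ (values′ , tripleFrom (suc n))
  state≡′ rewrite state≡ | mex≡a′ | c′≡ = refl

  sound′ : ∀ {y} → y ∈ values′ → Listed (suc n) y
  sound′ {y} p with ∈-++⁻ values p
  ... | inj₁ q                         = Listed-mono y (n≤1+n n) (sound q)
  ... | inj₂ (here refl)               = suc n , ≤-refl , inj₁ refl
  ... | inj₂ (there (here refl))       = suc n , ≤-refl , inj₂ (inj₁ refl)
  ... | inj₂ (there (there (here refl))) = suc n , ≤-refl , inj₂ (inj₂ refl)

  complete′ : ∀ {y} → Listed (suc n) y → y ∈ values′
  complete′ {zero} _ = ∈-++⁺ˡ (complete tt)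
  complete′ {suc y} (k , k≤1+n , e) with m≤n⇒m<n∨m≡n k≤1+n
  ... | inj₁ k<1+n = ∈-++⁺ˡ (complete (k , ≤-pred k<1+n , e))
  ... | inj₂ refl with e
  ...   | inj₁ refl        = ∈-++⁺ʳ values (here refl)
  ...   | inj₂ (inj₁ refl) = ∈-++⁺ʳ values (there (here refl))
  ...   | inj₂ (inj₂ refl) = ∈-++⁺ʳ values (there (there (here refl)))

  long′ : 4 + val00 (suc n) ≤ length values′
  long′ = ≤-trans (+-monoʳ-≤ 4 (proj₂ (val00-suc-bounds n)))
            (≤-trans (≤-reflexive (+-comm 3 (4 + val00 n)))
              (≤-trans (+-monoˡ-≤ 3 long) (≤-reflexive (sym (length-++ values)))))

invariant : ∀ n → StateInvariant n
invariant zero    = initial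
invariant (suc n) = next (invariant n)

ABC-suc : ∀ n → ABC (suc n) ≡ tripleFrom n
ABC-suc n rewrite StateInvariant.state≡ (invariant n) = refl

ABC⇔tripleFrom : ∀ t → (Σ ℕ λ m → (1 ≤ m) × (ABC m ≡ t)) ⇔ (∃ λ n → tripleFrom n ≡ t)
ABC⇔tripleFrom t = mk⇔ to from
  where
  to : (Σ ℕ λ m → (1 ≤ m) × (ABC m ≡ t)) → ∃ λ n → tripleFrom n ≡ t
  to (suc n , _ , e) = n , trans (sym (ABC-suc n)) e
  from : (∃ λ n → tripleFrom n ≡ t) → Σ ℕ λ m → (1 ≤ m) × (ABC m ≡ t)
  from (n , e) = suc n , s≤s z≤n , trans (ABC-suc n) e

tripleFrom⇔words : ∀ a b c →
  (∃ λ n → tripleFrom n ≡ (suc a , suc b , suc c))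
  ⇔
  (Σ Word λ w → (repF a ≈LZ (w ++ false ∷ false ∷ []))
              × (repF b ≈LZ (w ++ false ∷ true ∷ []))
              × (repF c ≈LZ (w ++ false ∷ true ∷ false ∷ [])))
tripleFrom⇔words a b c = mk⇔ to from
  where
  to : ∃ (λ n → tripleFrom n ≡ (suc a , suc b , suc c)) → _
  to (n , refl) = repF n , repF-val00 n , repF-val01 n , repF-val010 n
  from : _ → ∃ λ n → tripleFrom n ≡ (suc a , suc b , suc c)
  from (w , a≈ , b≈ , c≈) = value 0 w , cong₂ _,_ (cong suc a≡) (cong₂ _,_ (cong suc b≡) (cong suc c≡))
    where
    read : ∀ x u → repF x ≈LZ u → Zeckendorf u × value 0 u ≡ x
    read x u = Equivalence.to (repF-≈LZ x u)
    zw : Zeckendorf w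
    zw = Zeckendorf-++⁻ˡ w (false ∷ false ∷ []) (proj₁ (read a (w ++ false ∷ false ∷ []) a≈))
    a≡ : val00 (value 0 w) ≡ a
    a≡ = trans (sym (value-++00 w zw)) (proj₂ (read a (w ++ false ∷ false ∷ []) a≈))
    b≡ : val01 (value 0 w) ≡ b
    b≡ = trans (sym (value-++01 w zw)) (proj₂ (read b (w ++ false ∷ true ∷ []) b≈))
    c≡ : val010 (value 0 w) ≡ c
    c≡ = trans (sym (value-++010 w zw)) (proj₂ (read c (w ++ false ∷ true ∷ false ∷ []) c≈))

theorem6p25 : (a b c : ℕ) → 0 < a → a < b → b < c →
    ((Σ ℕ λ m → (1 ≤ m) × (ABC m ≡ (a , b , c)))
      ⇔
     (Σ Word λ w → (repF (a ∸ 1) ≈LZ (w ++ false ∷ false ∷ []))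
                 × (repF (b ∸ 1) ≈LZ (w ++ false ∷ true ∷ []))
                 × (repF (c ∸ 1) ≈LZ (w ++ false ∷ true ∷ false ∷ []))))
theorem6p25 (suc a) (suc b) (suc c) _ _ _ =
  ⇔-trans (ABC⇔tripleFrom (suc a , suc b , suc c)) (tripleFrom⇔words a b c)
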